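{- Let $T$ be a tree on at least two vertices and let $\mathcal{H}$ be a TD-coloring of $T$ using $\chi_{td}(T)$ colors. Then every support vertex of $T$ forms a color class of $\mathcal{H}$ by itself (i.e. no other vertex receives its color).
   Context: A total dominator coloring (TD-coloring) of a graph without isolated vertices is a proper vertex coloring in which every vertex is adjacent to all vertices of some color class; $\chi_{td}$ denotes the minimum number of colors in a TD-coloring. A support vertex is a vertex adjacent to a leaf (vertex of degree 1). -}

module Defs where

open import Data.Nat using (ℕ; _<_)
open import Data.Fin using (Fin)
open import Data.List using (List; []; _∷_)
open import Data.List.Relation.Unary.Unique.Propositional using (Unique)
open import Data.Product using (Σ; _×_)
open import Function.Definitions using (Surjective)
open import Relation.Binary.PropositionalEquality using (_≡_; _≢_)
open import Relation.Nullary using (¬_)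

record Graph (n : ℕ) : Set₁ where
  field
    Adj    : Fin n → Fin n → Set
    sym    : ∀ {u v} → Adj u v → Adj v u
    irrefl : ∀ {v} → ¬ Adj v v
open Graph public

data Walk {n : ℕ} (G : Graph n) : List (Fin n) → Fin n → Fin n → Set where
  here : ∀ v → Walk G (v ∷ []) v v
  step : ∀ {u w v xs} → Adj G u w → Walk G xs w v → Walk G (u ∷ xs) u v

Path : {n : ℕ} → Graph n → List (Fin n) → Fin n → Fin n → Set
Path G xs u v = Walk G xs u v × Unique xs

IsTree : {n : ℕ} → Graph n → Set
IsTree G = ∀ u v →
  Σ (List _) (λ xs → Path G xs u v) ×
  (∀ xs ys → Path G xs u v → Path G ys u v → xs ≡ ys)

IsLeaf : {n : ℕ} → Graph n → Fin n → Set
IsLeaf G v = Σ _ λ u → Adj G v u × (∀ w → Adj G v w → w ≡ u)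

IsSupport : {n : ℕ} → Graph n → Fin n → Set
IsSupport G v = Σ _ λ u → Adj G v u × IsLeaf G u

NoIsolated : {n : ℕ} → Graph n → Set
NoIsolated G = ∀ v → Σ _ λ u → Adj G v u

Proper : {n k : ℕ} → Graph n → (Fin n → Fin k) → Set
Proper G c = ∀ {u v} → Adj G u v → c u ≢ c v

Dominates : {n k : ℕ} → Graph n → (Fin n → Fin k) → Fin n → Fin k → Set
Dominates G c v i = ∀ u → c u ≡ i → Adj G v u

-- Total dominator colouring with exactly k (nonempty) colour classes.
IsTDColoring : {n k : ℕ} → Graph n → (Fin n → Fin k) → Set
IsTDColoring {k = k} G c =
  Surjective _≡_ _≡_ c × Proper G c × (∀ v → Σ (Fin k) λ i → Dominates G c v i)

HasTDColoring : {n : ℕ} → Graph n → ℕ → Set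
HasTDColoring {n} G k = Σ (Fin n → Fin k) λ c → IsTDColoring G c

IsChiTD : {n : ℕ} → Graph n → ℕ → Set
IsChiTD G k = HasTDColoring G k × (∀ m → m < k → ¬ HasTDColoring G m)

module Submission where

open import Defs
open import Data.Nat using (ℕ; _≤_)
open import Data.Fin using (Fin)
open import Data.Product using (_,_)
open import Relation.Binary.PropositionalEquality as ≡ using (_≡_; refl; trans; cong)

-- A leaf must dominate some colour class, which is nonempty, and the leaf's only
-- neighbour is its support vertex; so that class is exactly {support vertex}.

module _ {n k : ℕ} (G : Graph n) (c : Fin n → Fin k) where

  class-dominated-by-leaf⊆neighbour :
    ∀ {v l} → Adj G v l → IsLeaf G l → ∀ {i} → Dominates G c l i →
    ∀ u → c u ≡ i → u ≡ v
  class-dominated-by-leaf⊆neighbour v∼l (_ , _ , only-neighbour) dom u cu≡i =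
    trans (only-neighbour u (dom u cu≡i)) (≡.sym (only-neighbour _ (sym G v∼l)))

  support-colour-class-singleton :
    IsTDColoring G c → ∀ v → IsSupport G v → ∀ u → c u ≡ c v → u ≡ v
  support-colour-class-singleton (surj , _ , td) v (l , v∼l , leaf) u cu≡cv
    with td l
  ... | i , dom with surj i
  ... | w , c≡i =
    class-i u (trans cu≡cv (trans (cong c (≡.sym (class-i w (c≡i refl)))) (c≡i refl)))
    where
    class-i : ∀ x → c x ≡ i → x ≡ v
    class-i = class-dominated-by-leaf⊆neighbour v∼l leaf dom

proposition1 : (n : ℕ) → 2 ≤ n → (T : Graph n) → IsTree T →
    (k : ℕ) → IsChiTD T k → (c : Fin n → Fin k) → IsTDColoring T c →
    ∀ v → IsSupport T v → ∀ u → c u ≡ c v → u ≡ v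
proposition1 _ _ T _ _ _ c = support-colour-class-singleton T c
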